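{- There is no formula $F\in\mathsf{Form}_{\bot,\supset}$ such that $I(w,F)=0$ for every state $w\in W$ in every $\mathbf{S}_{\bot_w}$-model $\langle g,W,\leq,V\rangle$.
   Context: $\mathsf{Form}_{\bot,\supset}$: formulas built from a countable set $\mathsf{Prop}$ of propositional variables and the constant $\bot$ using binary connectives $\land,\lor,\to,\supset$. An $\mathbf{S}_{\bot_w}$-model is $\langle g,W,\leq,V\rangle$ with $W$ a set, $g\in W$, $\leq$ reflexive and transitive with $g\leq w$ for all $w$, $V:W\times(\mathsf{Prop}\cup\{\bot\})\to\{0,1\}$ such that $V(w_1,x)=1$ and $w_1\leq w_2$ imply $V(w_2,x)=1$, and $V(g,\bot)=0$. Interpretation: $I(w,p)=V(w,p)$, $I(w,\bot)=V(w,\bot)$; $I(w,A\land B)=1$ iff both are 1; $I(w,A\lor B)=1$ iff at least one is 1; $I(w,A\supset B)=1$ iff $I(g,A)\neq1$ or $I(w,B)=1$; $I(w,A\to B)=1$ iff for all $x\geq w$, $I(x,A)=1$ implies $I(x,B)=1$. -}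

module Defs where

open import Data.Nat using (ℕ)
open import Data.Bool using (Bool; true; false)
open import Data.Product using (_×_)
open import Data.Sum using (_⊎_)
open import Relation.Binary.PropositionalEquality using (_≡_)
open import Relation.Nullary using (¬_)

Prop : Set
Prop = ℕ

data Form : Set where
  var  : Prop → Form
  ⊥'   : Form
  _∧'_ : Form → Form → Form
  _∨'_ : Form → Form → Form
  _⇒_  : Form → Form → Form   -- intuitionistic implication  →
  _⊃_  : Form → Form → Form   -- global implication ⊃

data Atom : Set where
  atomVar : Prop → Atom
  atomBot : Atom

-- An S_{⊥_w}-model ⟨g, W, ≤, V⟩ (truth values 0/1 rendered as Bool).
record Model : Set₁ where
  field
    W        : Set
    g        : W
    _≤_      : W → W → Set
    ≤-refl   : ∀ w → w ≤ w
    ≤-trans  : ∀ {u v w} → u ≤ v → v ≤ w → u ≤ w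
    g-least  : ∀ w → g ≤ w
    V        : W → Atom → Bool
    V-mono   : ∀ {w₁ w₂} x → V w₁ x ≡ true → w₁ ≤ w₂ → V w₂ x ≡ true
    V-g-bot  : V g atomBot ≡ false

-- I(w, F) = 1, as a proposition.
module _ (M : Model) where
  open Model M

  I : W → Form → Set
  I w (var p)  = V w (atomVar p) ≡ true
  I w ⊥'       = V w atomBot ≡ true
  I w (A ∧' B) = I w A × I w B
  I w (A ∨' B) = I w A ⊎ I w B
  I w (A ⊃ B)  = ¬ (I g A) ⊎ I w B
  I w (A ⇒ B)  = ∀ x → w ≤ x → I x A → I x B

-- A world at which every atom, ⊥ included, is true forces every formula: the
-- valuation is monotone, so all its successors are such worlds too, and the
-- global implication ⊃ is satisfied through its consequent.  The two-point chain
-- false ≤ true, with every atom true exactly at true, is an S_{⊥_w}-model, so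
-- no formula is refuted at every state.
module Submission where

open import Defs
open import Data.Bool using (Bool; true; false; b≤b) renaming (_≤_ to _≤ᵇ_)
open import Data.Bool.Properties using (≤-refl; ≤-trans; ≤-minimum)
open import Data.Product using (Σ; _,_)
open import Data.Sum using (inj₁; inj₂)
open import Relation.Nullary using (¬_)
open import Relation.Binary.PropositionalEquality using (_≡_; refl)

module _ (M : Model) where
  open Model M

  AllAtomsTrue : W → Set
  AllAtomsTrue w = ∀ x → V w x ≡ true

  AllAtomsTrue-mono : ∀ {w v} → AllAtomsTrue w → w ≤ v → AllAtomsTrue v
  AllAtomsTrue-mono all w≤v x = V-mono x (all x) w≤v

  AllAtomsTrue⇒I : ∀ {w} → AllAtomsTrue w → ∀ F → I M w F
  AllAtomsTrue⇒I all (var p)  = all (atomVar p)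
  AllAtomsTrue⇒I all ⊥'       = all atomBot
  AllAtomsTrue⇒I all (A ∧' B) = AllAtomsTrue⇒I all A , AllAtomsTrue⇒I all B
  AllAtomsTrue⇒I all (A ∨' B) = inj₁ (AllAtomsTrue⇒I all A)
  AllAtomsTrue⇒I all (A ⊃ B)  = inj₂ (AllAtomsTrue⇒I all B)
  AllAtomsTrue⇒I all (A ⇒ B) x w≤x _ = AllAtomsTrue⇒I (AllAtomsTrue-mono all w≤x) B

true-upward : ∀ {b c} → b ≡ true → b ≤ᵇ c → c ≡ true
true-upward refl b≤b = refl

twoPointChain : Model
twoPointChain = record
  { W       = Bool
  ; g       = false
  ; _≤_     = _≤ᵇ_
  ; ≤-refl  = λ _ → ≤-refl
  ; ≤-trans = ≤-trans
  ; g-least = ≤-minimum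
  ; V       = λ w _ → w
  ; V-mono  = λ _ → true-upward
  ; V-g-bot = refl
  }

mainTheorem19 : ¬ (Σ Form (λ F → (M : Model) → (w : Model.W M) → ¬ I M w F))
mainTheorem19 (F , refuted) =
  refuted twoPointChain true (AllAtomsTrue⇒I twoPointChain (λ _ → refl) F)
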